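{- There is an algorithm which, given a regular subset $\mathcal{S}\subseteq\mathrm{GL}(2,\mathbb{Z})$ (presented by a finite automaton over $\Sigma$ recognizing a language $L$ with $\phi(L)=\mathcal{S}$) and a matrix $M\in\mathrm{GL}(2,\mathbb{Z})$, decides whether $M\in\mathcal{S}$.
   Context: $\mathrm{GL}(2,\mathbb{Z})$ is the group of $2\times 2$ integer matrices with determinant $\pm1$. Let $\Sigma=\{X,N,S,R\}$ and let $\phi:\Sigma^*\to\mathrm{GL}(2,\mathbb{Z})$ be the monoid morphism determined by $\phi(X)=\begin{bmatrix}-1&0\\0&-1\end{bmatrix}$, $\phi(N)=\begin{bmatrix}1&0\\0&-1\end{bmatrix}$, $\phi(S)=\begin{bmatrix}0&-1\\1&0\end{bmatrix}$, $\phi(R)=\begin{bmatrix}0&-1\\1&1\end{bmatrix}$. A subset $\mathcal{S}\subseteq\mathrm{GL}(2,\mathbb{Z})$ is called regular if $\mathcal{S}=\phi(L)$ for some regular language $L\subseteq\Sigma^*$. -}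

module Defs where

open import Data.Nat using (ℕ)
open import Data.Fin using (Fin)
open import Data.Bool using (Bool; true)
open import Data.Integer using (ℤ; +_; -_; _+_; _*_; _-_)
open import Data.List using (List; []; _∷_; foldr)
open import Data.Product using (∃; _×_; ∃-syntax)
open import Data.Sum using (_⊎_)
open import Relation.Binary.PropositionalEquality using (_≡_)

record Mat2 : Set where
  constructor mat
  field
    a b c d : ℤ

det : Mat2 → ℤ
det (mat a b c d) = a * d - b * c

InGL : Mat2 → Set
InGL M = det M ≡ + 1 ⊎ det M ≡ - (+ 1)

_⊗_ : Mat2 → Mat2 → Mat2
mat a b c d ⊗ mat a' b' c' d' =
  mat (a * a' + b * c') (a * b' + b * d') (c * a' + d * c') (c * b' + d * d')

I₂ : Mat2
I₂ = mat (+ 1) (+ 0) (+ 0) (+ 1)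

data Sym : Set where
  X N S R : Sym

φ₀ : Sym → Mat2
φ₀ X = mat (- (+ 1)) (+ 0) (+ 0) (- (+ 1))
φ₀ N = mat (+ 1) (+ 0) (+ 0) (- (+ 1))
φ₀ S = mat (+ 0) (- (+ 1)) (+ 1) (+ 0)
φ₀ R = mat (+ 0) (- (+ 1)) (+ 1) (+ 1)

φ : List Sym → Mat2
φ = foldr (λ x acc → φ₀ x ⊗ acc) I₂

record NFA : Set where
  field
    states  : ℕ
    initial : Fin states → Bool
    final   : Fin states → Bool
    δ       : Fin states → Sym → Fin states → Bool

module _ (A : NFA) where
  open NFA A

  data Run : Fin states → List Sym → Fin states → Set where
    done : ∀ {p} → Run p [] p
    step : ∀ {p x q r w} → δ p x q ≡ true → Run q w r → Run p (x ∷ w) r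

  Accepts : List Sym → Set
  Accepts w = ∃[ p ] ∃[ q ] (initial p ≡ true × Run p w q × final q ≡ true)

_∈φL_ : Mat2 → NFA → Set
M ∈φL A = ∃[ w ] (Accepts A w × φ w ≡ M)

-- Reading a word w, a pushdown transducer can maintain a factorisation φ(w) = R^i · W · F with
-- i < 3, W a product of U = [[1,1],[0,1]] and L = [[1,0],[1,1]], and F one of the eight signed
-- permutation matrices: right multiplication by a generator only changes the right end of such a
-- factorisation. The stack holds R^i below the letters of W, the finite control holds F. Run in
-- parallel with the automaton, it turns M ∈ φ(L) into reachability of one of finitely many
-- configurations of value M (W has nonnegative entries whose sum grows with its length), and
-- reachability of a given configuration of a pushdown system is decidable by saturating the
-- finitely many summaries of its runs.
module Submission where

open import Defs
open import Relation.Nullary using (Dec)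

open import Data.Bool using (Bool; true; false; T; not; _∨_; _xor_; if_then_else_)
open import Data.Bool.Properties using (T-∨; T-≡; T?)
import Data.Bool.Properties as Bool
open import Data.Empty using (⊥-elim)
open import Data.Fin using (Fin; zero; suc; toℕ; fromℕ)
open import Data.Fin.Properties using (toℕ-fromℕ)
import Data.Fin.Properties as Fin
open import Data.Integer using (+_; -_; _+_; _*_; ∣_∣)
import Data.Integer.Properties as ℤ
open import Data.Integer.Tactic.RingSolver using (solve-∀; solve)
open import Data.List using (List; []; _∷_; _++_; [_]; length; map; take; filter; allFin; cartesianProduct)
open import Data.List.Membership.Propositional using (_∈_; lose; find)
open import Data.List.Membership.Propositional.Properties
  using (∈-allFin; ∈-cartesianProduct⁺; ∈-map⁺; ∈-map⁻; ∈-filter⁺; ∈-filter⁻; ∈-++⁺ˡ; ∈-++⁺ʳ)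
open import Data.List.Properties
  using (take-all; ++-assoc; ++-identityʳ; ∷-injective; length-++-≤ˡ; length-++-≤ʳ)
import Data.List.Properties as List
open import Data.List.Relation.Unary.All as All using (all?)
open import Data.List.Relation.Unary.Any using (Any; here; there; any?; satisfied)
open import Data.Nat using (ℕ; zero; suc; _≤_; _<_; z≤n; s≤s)
import Data.Nat as ℕ
open import Data.Nat.Properties
  using (m≤m+n; m≤n+m; +-mono-≤; ≤-refl; ≤-trans; <-≤-trans; m≤n⇒m≤1+n; <-irrefl)
open import Data.Nat.Tactic.RingSolver using () renaming (solve-∀ to ℕ-solve-∀)
open import Data.Product using (Σ; ∃; ∃-syntax; _×_; _,_; proj₁; proj₂)
import Data.Product.Properties as Product
open import Data.Sum using (_⊎_; inj₁; inj₂)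
import Data.Sum.Properties as Sum
open import Function using (_∘_; Equivalence)
open import Relation.Binary.Definitions using (DecidableEquality)
open import Relation.Binary.PropositionalEquality
  using (_≡_; refl; sym; trans; cong; subst; module ≡-Reasoning)
open import Relation.Nullary using (yes; no; ¬_; contradiction)
open import Relation.Nullary.Decidable
  using (from-yes; ⌊_⌋; _×-dec_; _⊎-dec_; ¬?; toWitness; fromWitness; decidable-stable)
import Relation.Nullary.Decidable as Dec
open import Relation.Unary using (Decidable)

-- Finite types

record Finite (A : Set) : Set where
  field
    elements : List A
    complete : ∀ x → x ∈ elements

  ∃? : {P : A → Set} → Decidable P → Dec (∃ P)
  ∃? P? = Dec.map′ satisfied (λ (x , px) → lose (complete x) px) (any? P? elements)

  ∀? : {P : A → Set} → Decidable P → Dec (∀ x → P x)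
  ∀? P? = Dec.map′ (λ ps x → All.lookup ps (complete x)) (λ p → All.tabulate (λ {x} _ → p x))
                   (all? P? elements)

open Finite

Fin-finite : ∀ n → Finite (Fin n)
Fin-finite n = record { elements = allFin n ; complete = ∈-allFin }

Bool-finite : Finite Bool
Bool-finite = record { elements = true ∷ false ∷ [] ; complete = λ { true → here refl ; false → there (here refl) } }

_×-finite_ : {A B : Set} → Finite A → Finite B → Finite (A × B)
FA ×-finite FB = record
  { elements = cartesianProduct (elements FA) (elements FB)
  ; complete = λ (x , y) → ∈-cartesianProduct⁺ (complete FA x) (complete FB y) }

_⊎-finite_ : {A B : Set} → Finite A → Finite B → Finite (A ⊎ B)
FA ⊎-finite FB = record
  { elements = map inj₁ (elements FA) ++ map inj₂ (elements FB)
  ; complete = λ { (inj₁ x) → ∈-++⁺ˡ (∈-map⁺ inj₁ (complete FA x))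
                 ; (inj₂ y) → ∈-++⁺ʳ _ (∈-map⁺ inj₂ (complete FB y)) } }

Sym-finite : Finite Sym
Sym-finite = record
  { elements = X ∷ N ∷ S ∷ R ∷ []
  ; complete = λ { X → here refl ; N → there (here refl) ; S → there (there (here refl))
                 ; R → there (there (there (here refl))) } }

∃-bounded-list? : {A : Set} → Finite A → ∀ n {P : List A → Set} → Decidable P →
                  Dec (∃[ xs ] length xs ≤ n × P xs)
∃-bounded-list? A-finite zero    P? = Dec.map′ (λ p → [] , z≤n , p) (λ { ([] , _ , p) → p }) (P? [])
∃-bounded-list? A-finite (suc n) {P} P? =
  Dec.map′ shorter longer (P? [] ⊎-dec ∃? A-finite (λ x → ∃-bounded-list? A-finite n (P? ∘ (x ∷_))))
  where
  shorter : P [] ⊎ ∃[ x ] ∃[ xs ] length xs ≤ n × P (x ∷ xs) → ∃[ xs ] length xs ≤ suc n × P xs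
  shorter (inj₁ p)                = [] , z≤n , p
  shorter (inj₂ (x , xs , ≤n , p)) = x ∷ xs , s≤s ≤n , p
  longer : ∃[ xs ] length xs ≤ suc n × P xs → P [] ⊎ ∃[ x ] ∃[ xs ] length xs ≤ n × P (x ∷ xs)
  longer ([]     , _     , p) = inj₁ p
  longer (x ∷ xs , s≤s ≤n , p) = inj₂ (x , xs , ≤n , p)

-- Saturation

module Saturation {Fact : Set} (facts : Finite Fact)
                  (Step : (Fact → Set) → Fact → Set)
                  (step? : ∀ {K} → Decidable K → Decidable (Step K)) where

  iterate : ℕ → Fact → Bool
  iterate zero    f = false
  iterate (suc k) f = iterate k f ∨ ⌊ step? (T? ∘ iterate k) f ⌋

  _⊆_ : (Fact → Bool) → (Fact → Bool) → Set
  K ⊆ K′ = ∀ {f} → T (K f) → T (K′ f)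

  iterate-inflationary : ∀ k → iterate k ⊆ iterate (suc k)
  iterate-inflationary k = Equivalence.from T-∨ ∘ inj₁

  count : (Fact → Bool) → List Fact → ℕ
  count K []       = 0
  count K (f ∷ fs) = if K f then suc (count K fs) else count K fs

  count≤length : ∀ K fs → count K fs ≤ length fs
  count≤length K []       = z≤n
  count≤length K (f ∷ fs) with K f
  ... | true  = s≤s (count≤length K fs)
  ... | false = m≤n⇒m≤1+n (count≤length K fs)

  ⊆-true : ∀ {K K′ f} → K ⊆ K′ → K f ≡ true → K′ f ≡ true
  ⊆-true {f = f} sub Kf≡true = Equivalence.to T-≡ (sub {f} (Equivalence.from T-≡ Kf≡true))

  count-mono : ∀ {K K′} → K ⊆ K′ → ∀ fs → count K fs ≤ count K′ fs
  count-mono sub []       = z≤n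
  count-mono {K} {K′} sub (f ∷ fs) with K f in kf | K′ f in k′f
  ... | true  | true  = s≤s (count-mono sub fs)
  ... | true  | false with () ← trans (sym (⊆-true {K} {K′} {f} sub kf)) k′f
  ... | false | true  = m≤n⇒m≤1+n (count-mono sub fs)
  ... | false | false = count-mono sub fs

  count-strict : ∀ {K K′ f fs} → K ⊆ K′ → f ∈ fs → T (K′ f) → ¬ T (K f) → count K fs < count K′ fs
  count-strict {K} {K′} {f} sub (here {xs = fs} refl) new ¬old with K f | K′ f
  ... | true  | _     = contradiction _ ¬old
  ... | false | true  = s≤s (count-mono sub fs)
  count-strict {K} {K′} sub (there {x = g} f∈fs) new ¬old with K g in kg | K′ g in k′g
  ... | true  | true  = s≤s (count-strict sub f∈fs new ¬old)
  ... | true  | false with () ← trans (sym (⊆-true {K} {K′} {g} sub kg)) k′g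
  ... | false | true  = m≤n⇒m≤1+n (count-strict sub f∈fs new ¬old)
  ... | false | false = count-strict sub f∈fs new ¬old

  Stable : ℕ → Set
  Stable k = iterate (suc k) ⊆ iterate k

  stable-or-growing : ∀ k → Stable k ⊎ count (iterate k) (elements facts) < count (iterate (suc k)) (elements facts)
  stable-or-growing k with ∃? facts (λ f → T? (iterate (suc k) f) ×-dec ¬? (T? (iterate k f)))
  ... | yes (f , new , ¬old) = inj₂ (count-strict (iterate-inflationary k) (complete facts f) new ¬old)
  ... | no ∄new = inj₁ λ {f} new → decidable-stable (T? (iterate k f)) (λ ¬old → ∄new (f , new , ¬old))

  stable-or-large : ∀ k → ∃ Stable ⊎ k ≤ count (iterate k) (elements facts)
  stable-or-large zero = inj₂ z≤n
  stable-or-large (suc k) with stable-or-large k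
  ... | inj₁ stable = inj₁ stable
  ... | inj₂ k≤count with stable-or-growing k
  ...   | inj₁ stable = inj₁ (k , stable)
  ...   | inj₂ growth = inj₂ (<-≤-trans (s≤s k≤count) growth)

  stabilises : ∃ Stable
  stabilises with stable-or-large (suc (length (elements facts)))
  ... | inj₁ stable = stable
  ... | inj₂ large  = ⊥-elim (<-irrefl refl (≤-trans large (count≤length _ (elements facts))))

  lfp : Fact → Bool
  lfp = iterate (proj₁ stabilises)

  lfp-closed : ∀ {f} → Step (T ∘ lfp) f → T (lfp f)
  lfp-closed derived = proj₂ stabilises (Equivalence.from T-∨ (inj₂ (fromWitness {a? = step? (T? ∘ lfp) _} derived)))

  lfp-sound : {P : Fact → Set} → (∀ {K} → (∀ {f} → K f → P f) → ∀ {f} → Step K f → P f) →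
              ∀ {f} → T (lfp f) → P f
  lfp-sound {P} step-sound = iterate-sound (proj₁ stabilises)
    where
    iterate-sound : ∀ k {f} → T (iterate k f) → P f
    iterate-sound (suc k) {f} known with Equivalence.to T-∨ known
    ... | inj₁ old  = iterate-sound k old
    ... | inj₂ derived = step-sound (iterate-sound k) (toWitness derived)

-- Pushdown systems

prefix-of-prefix : {A : Set} (t : List A) (j : Fin (suc (length t))) (u v : List A) →
                   take (toℕ j) t ≡ u ++ v → ∃[ j′ ] take (toℕ {suc (length t)} j′) t ≡ u
prefix-of-prefix t       j       []      v e  = zero , refl
prefix-of-prefix []      zero    (x ∷ u) v ()
prefix-of-prefix (y ∷ t) zero    (x ∷ u) v ()
prefix-of-prefix (y ∷ t) (suc j) (x ∷ u) v e with ∷-injective e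
... | refl , e′ with prefix-of-prefix t j u v e′
...   | j′ , e″ = suc j′ , cong (y ∷_) e″

data Action (Γ : Set) : Set where
  pop     : Action Γ
  replace : Γ → Action Γ
  push    : Γ → Γ → Action Γ

written : {Γ : Set} → Action Γ → List Γ
written pop          = []
written (replace γ)  = γ ∷ []
written (push γ γ′)  = γ ∷ γ′ ∷ []

module Pushdown {C Γ Input : Set} (δ : C → Γ → Input → List (C × Action Γ)) where

  Config : Set
  Config = C × List Γ

  infix 4 _─[_]→_

  data _─[_]→_ : Config → List Input → Config → Set where
    stop : ∀ {κ} → κ ─[ [] ]→ κ
    move : ∀ {c γ s x c₁ a w κ} → (c₁ , a) ∈ δ c γ x → (c₁ , written a ++ s) ─[ w ]→ κ →
           (c , γ ∷ s) ─[ x ∷ w ]→ κ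

  run-++ : ∀ {κ₁ κ₂ κ₃ w₁ w₂} → κ₁ ─[ w₁ ]→ κ₂ → κ₂ ─[ w₂ ]→ κ₃ → κ₁ ─[ w₁ ++ w₂ ]→ κ₃
  run-++ stop          r = r
  run-++ (move tr r₁) r₂ = move tr (run-++ r₁ r₂)

  run-below : ∀ {c s c′ s′ w} u → (c , s) ─[ w ]→ (c′ , s′) → (c , s ++ u) ─[ w ]→ (c′ , s′ ++ u)
  run-below u stop = stop
  run-below {s = γ ∷ s} u (move {c₁ = c₁} {a = a} tr r) =
    move tr (subst (λ s₁ → (c₁ , s₁) ─[ _ ]→ _) (++-assoc (written a) s u) (run-below u r))

  run-split : ∀ s₁ {s₂ c w κ} → (c , s₁ ++ s₂) ─[ w ]→ κ →
              (∃[ c₁ ] ∃[ w₁ ] ∃[ w₂ ] w ≡ w₁ ++ w₂ × (c , s₁) ─[ w₁ ]→ (c₁ , []) × (c₁ , s₂) ─[ w₂ ]→ κ)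
              ⊎ (∃[ s′ ] proj₂ κ ≡ s′ ++ s₂ × (c , s₁) ─[ w ]→ (proj₁ κ , s′))
  run-split []       {c = c} {w} r = inj₁ (c , [] , w , refl , stop , r)
  run-split (γ ∷ s₁) stop = inj₂ (γ ∷ s₁ , refl , stop)
  run-split (γ ∷ s₁) {s₂} (move {x = x} {a = a} tr r)
    with run-split (written a ++ s₁) (subst (λ s → (_ , s) ─[ _ ]→ _) (sym (++-assoc (written a) s₁ s₂)) r)
  ... | inj₁ (c₁ , w₁ , w₂ , refl , r₁ , r₂) = inj₁ (c₁ , x ∷ w₁ , w₂ , refl , move tr r₁ , r₂)
  ... | inj₂ (s′ , refl , r₁)                = inj₂ (s′ , refl , move tr r₁)

  run-from-empty : ∀ {c w κ} → (c , []) ─[ w ]→ κ → w ≡ [] × κ ≡ (c , [])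
  run-from-empty stop = refl , refl

  module Summaries (C-finite : Finite C) (_≟C_ : DecidableEquality C)
                   (Γ-finite : Finite Γ) (_≟Γ_ : DecidableEquality Γ)
                   (Input-finite : Finite Input) (t : List Γ) where

    _≟S_ : DecidableEquality (List Γ)
    _≟S_ = List.≡-dec _≟Γ_

    Prefix : Set
    Prefix = Fin (suc (length t))

    prefix : Prefix → List Γ
    prefix j = take (toℕ j) t

    -- A run ending in a prefix of t splits into subruns that again end in prefixes of t,
    -- so summaries only need to record those targets.
    Fact : Set
    Fact = C × Γ × C × Prefix

    Reach : Fact → Set
    Reach (c , γ , c′ , j) = ∃[ w ] (c , [ γ ]) ─[ w ]→ (c′ , prefix j)

    -- How a run continues after the first move wrote a on the stack.
    Completes : (Fact → Set) → C → Action Γ → C → Prefix → Set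
    Completes K c₁ pop         c′ j = c₁ ≡ c′ × prefix j ≡ []
    Completes K c₁ (replace γ) c′ j = K (c₁ , γ , c′ , j)
    Completes K c₁ (push γ γ′) c′ j =
      (∃[ c₂ ] K (c₁ , γ , c₂ , zero) × K (c₂ , γ′ , c′ , j))
      ⊎ (∃[ j′ ] prefix j′ ++ [ γ′ ] ≡ prefix j × K (c₁ , γ , c′ , j′))

    Step : (Fact → Set) → Fact → Set
    Step K (c , γ , c′ , j) =
      (c ≡ c′ × [ γ ] ≡ prefix j) ⊎ ∃[ x ] Any (λ (c₁ , a) → Completes K c₁ a c′ j) (δ c γ x)

    completes? : ∀ {K} → Decidable K → ∀ c₁ a c′ j → Dec (Completes K c₁ a c′ j)
    completes? K? c₁ pop         c′ j = (c₁ ≟C c′) ×-dec (prefix j ≟S [])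
    completes? K? c₁ (replace γ) c′ j = K? _
    completes? K? c₁ (push γ γ′) c′ j =
      ∃? C-finite (λ c₂ → K? _ ×-dec K? _)
      ⊎-dec ∃? (Fin-finite _) (λ j′ → ((prefix j′ ++ [ γ′ ]) ≟S prefix j) ×-dec K? _)

    step? : ∀ {K} → Decidable K → Decidable (Step K)
    step? K? (c , γ , c′ , j) =
      ((c ≟C c′) ×-dec ([ γ ] ≟S prefix j))
      ⊎-dec ∃? Input-finite (λ x → any? (λ (c₁ , a) → completes? K? c₁ a c′ j) (δ c γ x))

    completes-sound : ∀ {K} → (∀ {f} → K f → Reach f) →
                      ∀ {c₁ a c′ j} → Completes K c₁ a c′ j → ∃[ w ] (c₁ , written a) ─[ w ]→ (c′ , prefix j)
    completes-sound sound {a = pop} (refl , e) = [] , subst (λ s → _ ─[ [] ]→ (_ , s)) (sym e) stop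
    completes-sound sound {a = replace γ} k = sound k
    completes-sound sound {a = push γ γ′} (inj₁ (c₂ , k₁ , k₂)) =
      let w₁ , r₁ = sound k₁ ; w₂ , r₂ = sound k₂ in
      w₁ ++ w₂ , run-++ (run-below [ γ′ ] r₁) r₂
    completes-sound sound {a = push γ γ′} (inj₂ (j′ , e , k)) =
      let w , r = sound k in
      w , subst (λ s → _ ─[ w ]→ (_ , s)) e (run-below [ γ′ ] r)

    step-sound : ∀ {K} → (∀ {f} → K f → Reach f) → ∀ {f} → Step K f → Reach f
    step-sound sound (inj₁ (refl , e)) = [] , subst (λ s → _ ─[ [] ]→ (_ , s)) e stop
    step-sound sound (inj₂ (x , completion)) =
      let (c₁ , a) , tr , k = find completion ; w , r = completes-sound sound k in
      x ∷ w , move tr (subst (λ s → (c₁ , s) ─[ w ]→ _) (sym (++-identityʳ (written a))) r)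

    -- Induction on the length of the input word, since run-split does not produce structural subruns.
    step-complete : ∀ {K} → (∀ {f} → Step K f → K f) →
                    ∀ n {c γ w c′ v} j → length w ≤ n → v ≡ prefix j → (c , [ γ ]) ─[ w ]→ (c′ , v) →
                    K (c , γ , c′ , j)
    step-complete closed n j _ v≡j stop = closed (inj₁ (refl , v≡j))
    step-complete {K} closed (suc n) {c′ = c′} {v} j (s≤s ∣w∣≤n) v≡j (move {c₁ = c₁} {a} {w} tr r) =
      closed (inj₂ (_ , lose tr (completes a (subst (λ s → (c₁ , s) ─[ w ]→ _) (++-identityʳ (written a)) r))))
      where
      completes : ∀ a → (c₁ , written a) ─[ w ]→ (c′ , v) → Completes K c₁ a c′ j
      completes pop r with run-from-empty r
      ... | refl , refl = refl , sym v≡j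
      completes (replace γ) r = step-complete closed n j ∣w∣≤n v≡j r
      completes (push γ γ′) r with run-split [ γ ] r
      ... | inj₁ (c₂ , w₁ , w₂ , refl , r₁ , r₂) =
        inj₁ (c₂ , step-complete closed n zero (≤-trans (length-++-≤ˡ w₁) ∣w∣≤n) refl r₁
                 , step-complete closed n j (≤-trans (length-++-≤ʳ w₂ {w₁}) ∣w∣≤n) v≡j r₂)
      ... | inj₂ (s′ , v≡s′γ′ , r₁) =
        let j′ , j′≡s′ = prefix-of-prefix t j s′ [ γ′ ] (trans (sym v≡j) v≡s′γ′) in
        inj₂ (j′ , trans (cong (_++ [ γ′ ]) j′≡s′) (trans (sym v≡s′γ′) v≡j)
                 , step-complete closed n j′ ∣w∣≤n (sym j′≡s′) r₁)

    open Saturation (C-finite ×-finite (Γ-finite ×-finite (C-finite ×-finite Fin-finite _))) Step step?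

    reach? : Decidable Reach
    reach? f with T? (lfp f)
    ... | yes known  = yes (lfp-sound step-sound known)
    ... | no unknown = no λ (w , r) → unknown (step-complete lfp-closed (length w) _ ≤-refl refl r)

    prefix-whole : prefix (fromℕ (length t)) ≡ t
    prefix-whole = trans (cong (λ n → take n t) (toℕ-fromℕ (length t))) (take-all (length t) t ≤-refl)

    reach-whole? : ∀ c γ c′ → Dec (∃[ w ] (c , [ γ ]) ─[ w ]→ (c′ , t))
    reach-whole? c γ c′ = subst (λ s → Dec (∃[ w ] (c , [ γ ]) ─[ w ]→ (c′ , s))) prefix-whole
                                (reach? (c , γ , c′ , fromℕ (length t)))

-- 2×2 integer matrices

mat-cong : ∀ {a b c d a′ b′ c′ d′} → a ≡ a′ → b ≡ b′ → c ≡ c′ → d ≡ d′ → mat a b c d ≡ mat a′ b′ c′ d′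
mat-cong refl refl refl refl = refl

⊗-assoc : ∀ P Q U → (P ⊗ Q) ⊗ U ≡ P ⊗ (Q ⊗ U)
⊗-assoc (mat a b c d) (mat e f g h) (mat i j k l) =
  mat-cong (entry a b i k) (entry a b j l) (entry c d i k) (entry c d j l)
  where
  entry : ∀ x y z w → (x * e + y * g) * z + (x * f + y * h) * w ≡ x * (e * z + f * w) + y * (g * z + h * w)
  entry x y z w = solve (x ∷ y ∷ z ∷ w ∷ e ∷ f ∷ g ∷ h ∷ [])

·1+·0 : ∀ x y → x * + 1 + y * + 0 ≡ x
·1+·0 = solve-∀

·0+·1 : ∀ x y → x * + 0 + y * + 1 ≡ y
·0+·1 = solve-∀

·1+·1 : ∀ m n → + m * + 1 + + n * + 1 ≡ + (m ℕ.+ n)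
·1+·1 m n = trans (·1+·1′ (+ m) (+ n)) (sym (ℤ.pos-+ m n))
  where
  ·1+·1′ : ∀ x y → x * + 1 + y * + 1 ≡ x + y
  ·1+·1′ = solve-∀

⊗-identityˡ : ∀ M → I₂ ⊗ M ≡ M
⊗-identityˡ (mat a b c d) = mat-cong (first a c) (first b d) (second a c) (second b d)
  where
  first : ∀ x y → + 1 * x + + 0 * y ≡ x
  first = solve-∀
  second : ∀ x y → + 0 * x + + 1 * y ≡ y
  second = solve-∀

⊗-identityʳ : ∀ M → M ⊗ I₂ ≡ M
⊗-identityʳ (mat a b c d) = mat-cong (·1+·0 a b) (·0+·1 a b) (·1+·0 c d) (·0+·1 c d)

⊗-cancel : ∀ {P P′ Q U U′ M} → P′ ⊗ P ≡ I₂ → U ⊗ U′ ≡ I₂ → (P ⊗ Q) ⊗ U ≡ M → Q ≡ (P′ ⊗ M) ⊗ U′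
⊗-cancel {P} {P′} {Q} {U} {U′} {M} P′P≡I UU′≡I PQU≡M = begin
  Q                              ≡⟨ sym (⊗-identityˡ Q) ⟩
  I₂ ⊗ Q                         ≡⟨ cong (_⊗ Q) (sym P′P≡I) ⟩
  (P′ ⊗ P) ⊗ Q                   ≡⟨ ⊗-assoc P′ P Q ⟩
  P′ ⊗ (P ⊗ Q)                   ≡⟨ sym (⊗-identityʳ (P′ ⊗ (P ⊗ Q))) ⟩
  (P′ ⊗ (P ⊗ Q)) ⊗ I₂            ≡⟨ cong ((P′ ⊗ (P ⊗ Q)) ⊗_) (sym UU′≡I) ⟩
  (P′ ⊗ (P ⊗ Q)) ⊗ (U ⊗ U′)      ≡⟨ sym (⊗-assoc (P′ ⊗ (P ⊗ Q)) U U′) ⟩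
  ((P′ ⊗ (P ⊗ Q)) ⊗ U) ⊗ U′      ≡⟨ cong (_⊗ U′) (⊗-assoc P′ (P ⊗ Q) U) ⟩
  (P′ ⊗ ((P ⊗ Q) ⊗ U)) ⊗ U′      ≡⟨ cong (λ N → (P′ ⊗ N) ⊗ U′) PQU≡M ⟩
  (P′ ⊗ M) ⊗ U′                  ∎
  where open ≡-Reasoning

infix 4 _≟M_

_≟M_ : DecidableEquality Mat2
mat a b c d ≟M mat a′ b′ c′ d′ =
  Dec.map′ (λ (a≡ , b≡ , c≡ , d≡) → mat-cong a≡ b≡ c≡ d≡) (λ { refl → refl , refl , refl , refl })
           ((a ℤ.≟ a′) ×-dec (b ℤ.≟ b′) ×-dec (c ℤ.≟ c′) ×-dec (d ℤ.≟ d′))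

transpose : Mat2 → Mat2
transpose (mat a b c d) = mat a c b d

entrySum : Mat2 → ℕ
entrySum (mat a b c d) = ∣ a ∣ ℕ.+ ∣ b ∣ ℕ.+ ∣ c ∣ ℕ.+ ∣ d ∣

-- The normal-form transducer

infix 25 _^ᵇ_

_^ᵇ_ : Mat2 → Bool → Mat2
M ^ᵇ true  = M
M ^ᵇ false = I₂

swap : Mat2
swap = mat (+ 0) (+ 1) (+ 1) (+ 0)

-- (s , x , u) stands for S^s (−I)^x P^u, where P is swap: the eight signed permutation matrices.
Frame : Set
Frame = Bool × Bool × Bool

frame : Frame → Mat2
frame (s , x , u) = (φ₀ S ^ᵇ s ⊗ φ₀ X ^ᵇ x) ⊗ swap ^ᵇ u

unit-frame : Frame
unit-frame = false , false , false

_≟F_ : DecidableEquality Frame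
_≟F_ = Product.≡-dec Bool._≟_ (Product.≡-dec Bool._≟_ Bool._≟_)

Frame-finite : Finite Frame
Frame-finite = Bool-finite ×-finite (Bool-finite ×-finite Bool-finite)

frame-orthogonal : ∀ f → frame f ⊗ transpose (frame f) ≡ I₂
frame-orthogonal = from-yes (∀? Frame-finite (λ f → frame f ⊗ transpose (frame f) ≟M I₂))

-- S² = −I is central and P S P = S⁻¹.
_·S : Frame → Frame
(s , x , u) ·S = not s , x xor (s xor u) , u

_·P : Frame → Frame
(s , x , u) ·P = s , x , not u

_·X : Frame → Frame
(s , x , u) ·X = s , not x , u

Letter : Set
Letter = Fin 2

pattern U = zero
pattern L = suc zero

Base : Set
Base = Fin 3

pattern R⁰ = zero
pattern R¹ = suc zero
pattern R² = suc (suc zero)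

StackSymbol : Set
StackSymbol = Letter ⊎ Base

pattern letter ℓ = inj₁ ℓ
pattern base b = inj₂ b

⟦_⟧ : StackSymbol → Mat2
⟦ letter U ⟧ = mat (+ 1) (+ 1) (+ 0) (+ 1)
⟦ letter L ⟧ = mat (+ 1) (+ 0) (+ 1) (+ 1)
⟦ base R⁰ ⟧  = I₂
⟦ base R¹ ⟧  = φ₀ R
⟦ base R² ⟧  = φ₀ R ⊗ φ₀ R

StackSymbol-finite : Finite StackSymbol
StackSymbol-finite = Fin-finite 2 ⊎-finite Fin-finite 3

_≟Γ_ : DecidableEquality StackSymbol
_≟Γ_ = Sum.≡-dec Fin._≟_ Fin._≟_

stackValue : List StackSymbol → Mat2
stackValue []      = I₂
stackValue (γ ∷ s) = stackValue s ⊗ ⟦ γ ⟧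

value : Frame × List StackSymbol → Mat2
value (f , s) = stackValue s ⊗ frame f

stackValue-++ : ∀ s s′ → stackValue (s ++ s′) ≡ stackValue s′ ⊗ stackValue s
stackValue-++ []      s′ = sym (⊗-identityʳ (stackValue s′))
stackValue-++ (γ ∷ s) s′ = trans (cong (_⊗ ⟦ γ ⟧) (stackValue-++ s s′)) (⊗-assoc (stackValue s′) (stackValue s) ⟦ γ ⟧)

-- ⟦ γ ⟧ S^s R^(±1) = stackValue (written a) S^s′ (−I)^x′, with R^(−1) when u holds:
-- U R = L, L R = S, S R = −U, U R⁻¹ = −S, L R⁻¹ = U, S R⁻¹ = L and R³ = −I.
rotate : StackSymbol → Bool → Bool → Action StackSymbol × Bool × Bool
rotate γ         true  false = push (letter U) γ , false , true
rotate γ         true  true  = push (letter L) γ , false , false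
rotate (letter U) false false = replace (letter L) , false , false
rotate (letter L) false false = pop , true , false
rotate (base R⁰)  false false = replace (base R¹) , false , false
rotate (base R¹)  false false = replace (base R²) , false , false
rotate (base R²)  false false = replace (base R⁰) , false , true
rotate (letter U) false true  = pop , true , true
rotate (letter L) false true  = replace (letter U) , false , false
rotate (base R⁰)  false true  = replace (base R²) , false , true
rotate (base R¹)  false true  = replace (base R⁰) , false , false
rotate (base R²)  false true  = replace (base R¹) , false , false

-- N = P S, and P R P = R⁻¹ moves R past the swap part of the frame.
τ : Frame → StackSymbol → Sym → Frame × Action StackSymbol
τ f           γ X = f ·X , replace γ
τ f           γ N = (f ·P) ·S , replace γ
τ f           γ S = f ·S , replace γ
τ (s , x , u) γ R = let a , s′ , x′ = rotate γ s u in (s′ , x xor x′ , u) , a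

RightMultiplies : Frame → StackSymbol → Sym → Set
RightMultiplies f γ x = let f′ , a = τ f γ x in stackValue (written a) ⊗ frame f′ ≡ (⟦ γ ⟧ ⊗ frame f) ⊗ φ₀ x

τ-correct : ∀ f γ x → RightMultiplies f γ x
τ-correct f γ x = from-yes (∀? (Frame-finite ×-finite (StackSymbol-finite ×-finite Sym-finite))
                                {P = λ (f , γ , x) → RightMultiplies f γ x} (λ _ → _ ≟M _)) (f , γ , x)

τ-value : ∀ f γ x s → let f′ , a = τ f γ x in value (f′ , written a ++ s) ≡ value (f , γ ∷ s) ⊗ φ₀ x
τ-value f γ x s = begin
  stackValue (written a ++ s) ⊗ frame f′          ≡⟨ cong (_⊗ frame f′) (stackValue-++ (written a) s) ⟩
  (stackValue s ⊗ stackValue (written a)) ⊗ frame f′ ≡⟨ ⊗-assoc (stackValue s) _ _ ⟩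
  stackValue s ⊗ (stackValue (written a) ⊗ frame f′) ≡⟨ cong (stackValue s ⊗_) (τ-correct f γ x) ⟩
  stackValue s ⊗ ((⟦ γ ⟧ ⊗ frame f) ⊗ φ₀ x)        ≡⟨ sym (⊗-assoc (stackValue s) _ _) ⟩
  (stackValue s ⊗ (⟦ γ ⟧ ⊗ frame f)) ⊗ φ₀ x        ≡⟨ cong (_⊗ φ₀ x) (sym (⊗-assoc (stackValue s) ⟦ γ ⟧ (frame f))) ⟩
  ((stackValue s ⊗ ⟦ γ ⟧) ⊗ frame f) ⊗ φ₀ x        ∎
  where
  open ≡-Reasoning
  f′ = proj₁ (τ f γ x)
  a  = proj₂ (τ f γ x)

data WellFormed : List StackSymbol → Set where
  bottom : ∀ b → WellFormed [ base b ]
  _◂_    : ∀ ℓ {s} → WellFormed s → WellFormed (letter ℓ ∷ s)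

rotate-wf : ∀ {γ s} σ u → WellFormed (γ ∷ s) → WellFormed (written (proj₁ (rotate γ σ u)) ++ s)
rotate-wf true  false wf          = U ◂ wf
rotate-wf true  true  wf          = L ◂ wf
rotate-wf false false (U ◂ wf)    = L ◂ wf
rotate-wf false false (L ◂ wf)    = wf
rotate-wf false false (bottom R⁰) = bottom R¹
rotate-wf false false (bottom R¹) = bottom R²
rotate-wf false false (bottom R²) = bottom R⁰
rotate-wf false true  (U ◂ wf)    = wf
rotate-wf false true  (L ◂ wf)    = U ◂ wf
rotate-wf false true  (bottom R⁰) = bottom R²
rotate-wf false true  (bottom R¹) = bottom R⁰
rotate-wf false true  (bottom R²) = bottom R¹

τ-wf : ∀ f {γ s} x → WellFormed (γ ∷ s) → WellFormed (written (proj₂ (τ f γ x)) ++ s)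
τ-wf f           X wf = wf
τ-wf f           N wf = wf
τ-wf f           S wf = wf
τ-wf (σ , x , u) R wf = rotate-wf σ u wf

stack : List Letter → Base → List StackSymbol
stack ws b = map letter ws ++ [ base b ]

wf-stack : ∀ {s} → WellFormed s → ∃[ ws ] ∃[ b ] s ≡ stack ws b
wf-stack (bottom b) = [] , b , refl
wf-stack (ℓ ◂ wf)   = let ws , b , s≡ = wf-stack wf in ℓ ∷ ws , b , cong (letter ℓ ∷_) s≡

word : List Letter → Mat2
word ws = stackValue (map letter ws)

stackValue-stack : ∀ ws b → stackValue (stack ws b) ≡ ⟦ base b ⟧ ⊗ word ws
stackValue-stack ws b = trans (stackValue-++ (map letter ws) [ base b ]) (cong (_⊗ word ws) (⊗-identityˡ ⟦ base b ⟧))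

record Nonnegative (n : ℕ) (M : Mat2) : Set where
  field
    a b c d : ℕ
    entries : M ≡ mat (+ a) (+ b) (+ c) (+ d)
    a-pos   : 1 ≤ a
    d-pos   : 1 ≤ d
    large   : n ≤ a ℕ.+ b ℕ.+ c ℕ.+ d

word-nonnegative : ∀ ws → Nonnegative (length ws) (word ws)
word-nonnegative [] = record
  { a = 1 ; b = 0 ; c = 0 ; d = 1 ; entries = refl ; a-pos = ≤-refl ; d-pos = ≤-refl ; large = z≤n }
word-nonnegative (U ∷ ws) = record
  { a = a ; b = a ℕ.+ b ; c = c ; d = c ℕ.+ d
  ; entries = trans (cong (_⊗ ⟦ letter U ⟧) entries)
                    (mat-cong (·1+·0 (+ a) (+ b)) (·1+·1 a b) (·1+·0 (+ c) (+ d)) (·1+·1 c d))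
  ; a-pos = a-pos
  ; d-pos = ≤-trans d-pos (m≤n+m d c)
  ; large = subst (suc (length ws) ≤_) (sum-U a b c d) (+-mono-≤ (≤-trans a-pos (m≤m+n a c)) large) }
  where
  open Nonnegative (word-nonnegative ws)
  sum-U : ∀ a b c d → (a ℕ.+ c) ℕ.+ (a ℕ.+ b ℕ.+ c ℕ.+ d) ≡ a ℕ.+ (a ℕ.+ b) ℕ.+ c ℕ.+ (c ℕ.+ d)
  sum-U = ℕ-solve-∀
word-nonnegative (L ∷ ws) = record
  { a = a ℕ.+ b ; b = b ; c = c ℕ.+ d ; d = d
  ; entries = trans (cong (_⊗ ⟦ letter L ⟧) entries)
                    (mat-cong (·1+·1 a b) (·0+·1 (+ a) (+ b)) (·1+·1 c d) (·0+·1 (+ c) (+ d)))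
  ; a-pos = ≤-trans a-pos (m≤m+n a b)
  ; d-pos = d-pos
  ; large = subst (suc (length ws) ≤_) (sum-L a b c d) (+-mono-≤ (≤-trans d-pos (m≤n+m d b)) large) }
  where
  open Nonnegative (word-nonnegative ws)
  sum-L : ∀ a b c d → (b ℕ.+ d) ℕ.+ (a ℕ.+ b ℕ.+ c ℕ.+ d) ≡ (a ℕ.+ b) ℕ.+ b ℕ.+ (c ℕ.+ d) ℕ.+ d
  sum-L = ℕ-solve-∀

length≤entrySum : ∀ ws → length ws ≤ entrySum (word ws)
length≤entrySum ws = subst (λ M → length ws ≤ entrySum M) (sym entries) large
  where open Nonnegative (word-nonnegative ws)

baseInverse : Base → Mat2
baseInverse R⁰ = I₂
baseInverse R¹ = mat (+ 1) (+ 1) (- (+ 1)) (+ 0)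
baseInverse R² = mat (+ 0) (+ 1) (- (+ 1)) (- (+ 1))

base-inverse : ∀ b → baseInverse b ⊗ ⟦ base b ⟧ ≡ I₂
base-inverse R⁰ = refl
base-inverse R¹ = refl
base-inverse R² = refl

stackBound : Mat2 → Base → Frame → ℕ
stackBound M b f = entrySum ((baseInverse b ⊗ M) ⊗ transpose (frame f))

stack-bounded : ∀ {M f ws b} → value (f , stack ws b) ≡ M → length ws ≤ stackBound M b f
stack-bounded {M} {f} {ws} {b} value≡M = subst (λ N → length ws ≤ entrySum N) word≡ (length≤entrySum ws)
  where
  factorised : (⟦ base b ⟧ ⊗ word ws) ⊗ frame f ≡ M
  factorised = trans (cong (_⊗ frame f) (sym (stackValue-stack ws b))) value≡M
  word≡ : word ws ≡ (baseInverse b ⊗ M) ⊗ transpose (frame f)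
  word≡ = ⊗-cancel {P′ = baseInverse b} {U′ = transpose (frame f)} (base-inverse b) (frame-orthogonal f) factorised

-- Recognising φ(L)

module Recognition (A : NFA) where
  open NFA A using (states; initial; final)

  Control : Set
  Control = Fin states × Frame

  enabled? : ∀ p x → Decidable (λ q → NFA.δ A p x q ≡ true)
  enabled? p x q = NFA.δ A p x q Bool.≟ true

  transitions : Control → StackSymbol → Sym → List (Control × Action StackSymbol)
  transitions (p , f) γ x =
    map (λ q → (q , proj₁ (τ f γ x)) , proj₂ (τ f γ x)) (filter (enabled? p x) (allFin states))

  open Pushdown transitions

  transition-sound : ∀ {p f γ x c a} → (c , a) ∈ transitions (p , f) γ x →
                     ∃[ q ] NFA.δ A p x q ≡ true × (c , a) ≡ ((q , proj₁ (τ f γ x)) , proj₂ (τ f γ x))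
  transition-sound {p} {x = x} tr with ∈-map⁻ _ tr
  ... | q , q∈ , refl = q , proj₂ (∈-filter⁻ (enabled? p x) {xs = allFin states} q∈) , refl

  transition-complete : ∀ {p f γ x q} → NFA.δ A p x q ≡ true →
                        ((q , proj₁ (τ f γ x)) , proj₂ (τ f γ x)) ∈ transitions (p , f) γ x
  transition-complete {p} {x = x} δ≡ = ∈-map⁺ _ (∈-filter⁺ (enabled? p x) (∈-allFin _) δ≡)

  run-sound : ∀ {p f s w q f′ s′} → ((p , f) , s) ─[ w ]→ ((q , f′) , s′) →
              Run A p w q × value (f′ , s′) ≡ value (f , s) ⊗ φ w
  run-sound stop = done , sym (⊗-identityʳ _)
  run-sound {f = f} {γ ∷ s} {x ∷ w} (move tr r) with transition-sound tr
  ... | q₁ , δ≡ , refl =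
    let run , value≡ = run-sound r in
    step δ≡ run
    , trans value≡ (trans (cong (_⊗ φ w) (τ-value f γ x s)) (⊗-assoc (value (f , γ ∷ s)) (φ₀ x) (φ w)))

  run-complete : ∀ {p w q} → Run A p w q → ∀ f {s} → WellFormed s →
                 ∃[ f′ ] ∃[ s′ ] ((p , f) , s) ─[ w ]→ ((q , f′) , s′) × WellFormed s′
  run-complete done                  f        wf = f , _ , stop , wf
  run-complete (step {x = x} δ≡ run) f {γ ∷ s} wf =
    let f′ , s′ , r , wf′ = run-complete run (proj₁ (τ f γ x)) (τ-wf f x wf) in
    f′ , s′ , move (transition-complete δ≡) r , wf′

  Reaches : Fin states → Fin states → Frame → List StackSymbol → Set
  Reaches p q f s = ∃[ w ] ((p , unit-frame) , [ base R⁰ ]) ─[ w ]→ ((q , f) , s)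

  reaches? : ∀ p q f s → Dec (Reaches p q f s)
  reaches? p q f s = reach-whole? (p , unit-frame) (base R⁰) (q , f)
    where open Summaries (Fin-finite states ×-finite Frame-finite) (Product.≡-dec Fin._≟_ _≟F_)
                         StackSymbol-finite _≟Γ_ Sym-finite s

  Accepting : Mat2 → Fin states → Fin states → Frame → List StackSymbol → Set
  Accepting M p q f s = initial p ≡ true × final q ≡ true × value (f , s) ≡ M × Reaches p q f s

  Witness : Mat2 → Set
  Witness M = Σ (Fin states × Fin states × Frame × Base) λ (p , q , f , b) →
                ∃[ ws ] length ws ≤ stackBound M b f × Accepting M p q f (stack ws b)

  witness? : ∀ M → Dec (Witness M)
  witness? M =
    ∃? (Fin-finite states ×-finite (Fin-finite states ×-finite (Frame-finite ×-finite Fin-finite 3)))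
       λ (p , q , f , b) → ∃-bounded-list? (Fin-finite 2) (stackBound M b f) λ ws →
         (initial p Bool.≟ true) ×-dec (final q Bool.≟ true) ×-dec (value (f , stack ws b) ≟M M)
         ×-dec reaches? p q f (stack ws b)

  witness-sound : ∀ {M} → Witness M → M ∈φL A
  witness-sound (_ , _ , _ , init , fin , value≡M , w , r) =
    let run , value≡ = run-sound r in
    w , (_ , _ , init , run , fin) , trans (sym (⊗-identityˡ (φ w))) (trans (sym value≡) value≡M)

  witness-complete : ∀ {M} → M ∈φL A → Witness M
  witness-complete (w , (p , q , init , run , fin) , φw≡M) with run-complete run unit-frame (bottom R⁰)
  ... | f , s , r , wf with wf-stack wf
  ...   | ws , b , refl =
    let value≡M = trans (proj₂ (run-sound r)) (trans (⊗-identityˡ (φ w)) φw≡M) in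
    (p , q , f , b) , ws , stack-bounded {f = f} {ws} {b} value≡M , init , fin , value≡M , w , r

open Recognition using (witness?; witness-sound; witness-complete)

-- Membership is decidable for every integer matrix.
proposition2 : (A : NFA) (M : Mat2) → InGL M → Dec (M ∈φL A)
proposition2 A M _ = Dec.map′ (witness-sound A) (witness-complete A) (witness? A M)
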